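{- Let $n\ge 1$, let $\pi$ be a DI-sortable permutation of $[n]$ with ADI word $W$, and let $i\in[n]$ with $\pi_i\neq n$. If $\mathsf{C}_{\pi_i}$ does not appear immediately before $\mathsf{C}_{\pi_i+1}$ in $W$, then $\mathsf{C}_{\pi_i}$ appears before $\mathsf{E}_{\pi_i+1}$ in $W$.
   Context: A permutation $\pi=\pi_1\cdots\pi_n$ of $[n]$ is processed by a machine consisting of an input (initially $\pi_1,\dots,\pi_n$, read left to right), a first stack, a second stack, and an output, with operations: $\mathsf{E}$ moves the next input entry onto the top of the first stack; $\mathsf{N}$ pops the top of the first stack and pushes it onto the second stack; $\mathsf{C}$ pops the top of the second stack to the output. A sorting word of $\pi$ is a word over $\{\mathsf{E},\mathsf{N},\mathsf{C}\}$ whose operations are all legal when applied in order starting from $\pi$ in the input and empty stacks, and whose final output is $12\cdots n$. A DI word is a sorting word during which the first stack's entries always decrease from top to bottom and the second stack's entries always increase from top to bottom; $\pi$ is DI-sortable if it has a DI word. In a sorting word, the unique occurrences of $\mathsf{E},\mathsf{N},\mathsf{C}$ moving value $j$ are denoted $\mathsf{E}_j,\mathsf{N}_j,\mathsf{C}_j$. The ADI word of a DI-sortable $\pi$ is the word of operations performed by the following algorithm, which at each stage performs the first applicable step: (1) if the top entry of the second stack is the smallest value not yet output, perform $\mathsf{C}$; (2) if the first stack is nonempty and its $m$ entries are exactly the next $m$ values to be output, transfer all of them to the second stack by $m$ successive $\mathsf{N}$ operations; (3) otherwise, if the next input entry is smaller than the top of the second stack and larger than the top of the first stack (each comparison counting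 as satisfied if the corresponding stack is empty), perform $\mathsf{E}$; (4) otherwise perform $\mathsf{N}$. It is known that for every DI-sortable permutation this algorithm produces a DI word of it. -}

module Defs where

open import Data.Nat using (ℕ; zero; suc; _+_; _*_; _<_; _<?_; _≟_)
open import Data.Bool using (Bool; true; false; _∧_; if_then_else_)
open import Data.List using (List; []; _∷_; _++_; [_]; length; take; filter; upTo; map)
open import Data.List.Relation.Unary.Linked using (Linked)
open import Data.List.Relation.Binary.Permutation.Propositional using (_↭_)
open import Data.List.Membership.DecPropositional _≟_ using (_∈?_; _∉?_)
open import Data.Maybe using (Maybe; just; nothing)
open import Data.Product using (_×_; _,_; ∃; Σ)
open import Relation.Binary.PropositionalEquality using (_≡_)
open import Relation.Nullary.Decidable using (⌊_⌋)

oneTo : ℕ → List ℕ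
oneTo n = map suc (upTo n)

-- a permutation of [n], in one-line notation π₁ ⋯ πₙ
IsPerm : ℕ → List ℕ → Set
IsPerm n π = π ↭ oneTo n

data Op : Set where
  E N C : Op

-- machine state; stacks are lists with the head as the TOP;
-- the output is listed in the order in which entries were output
record State : Set where
  constructor st
  field
    input  : List ℕ
    stack1 : List ℕ
    stack2 : List ℕ
    output : List ℕ
open State public

initial : List ℕ → State
initial π = st π [] [] []

step : Op → State → Maybe (State × ℕ)
step E (st (x ∷ xs) s1 s2 o) = just (st xs (x ∷ s1) s2 o , x)
step E (st [] _ _ _) = nothing
step N (st i (x ∷ s1) s2 o) = just (st i s1 (x ∷ s2) o , x)
step N (st _ [] _ _) = nothing
step C (st i s1 (x ∷ s2) o) = just (st i s1 s2 (o ++ [ x ]) , x)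
step C (st _ _ [] _) = nothing

run : List Op → State → Maybe State
run [] s = just s
run (o ∷ w) s with step o s
... | nothing = nothing
... | just (s' , _) = run w s'

-- the word with each operation labelled by the value it moves
-- (o , j) stands for o_j ; stops at the first illegal operation
labelled : List Op → State → List (Op × ℕ)
labelled [] s = []
labelled (o ∷ w) s with step o s
... | nothing = []
... | just (s' , j) = (o , j) ∷ labelled w s'

SortingWord : ℕ → List ℕ → List Op → Set
SortingWord n π w = ∃ λ s → run w (initial π) ≡ just s × output s ≡ oneTo n

DIState : State → Set
DIState s = Linked (λ x y → y < x) (stack1 s) × Linked _<_ (stack2 s)

DIWord : ℕ → List ℕ → List Op → Set
DIWord n π w = SortingWord n π w ×
  (∀ k → ∃ λ s → run (take k w) (initial π) ≡ just s × DIState s)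

DISortable : ℕ → List ℕ → Set
DISortable n π = ∃ λ w → DIWord n π w

notOutput : ℕ → State → List ℕ
notOutput n s = filter (_∉? output s) (oneTo n)

replicateN : ℕ → List Op
replicateN zero = []
replicateN (suc m) = N ∷ replicateN m

ltTop : ℕ → List ℕ → Bool
ltTop x [] = true
ltTop x (y ∷ _) = ⌊ x <? y ⌋

gtTop : ℕ → List ℕ → Bool
gtTop x [] = true
gtTop x (y ∷ _) = ⌊ y <? x ⌋

step1? : ℕ → State → Bool
step1? n s with stack2 s | notOutput n s
... | x ∷ _ | v ∷ _ = ⌊ x ≟ v ⌋
... | _ | _ = false

allB : (ℕ → Bool) → List ℕ → Bool
allB p [] = true
allB p (x ∷ xs) = p x ∧ allB p xs

-- step (2): first stack nonempty and its m entries are exactly the next m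
-- values to be output (entries are distinct, so membership + count suffices)
step2? : ℕ → State → Bool
step2? n s with stack1 s
... | [] = false
... | s1@(_ ∷ _) =
  ⌊ length (take (length s1) (notOutput n s)) ≟ length s1 ⌋ ∧
  allB (λ x → ⌊ x ∈? take (length s1) (notOutput n s) ⌋) s1

step3? : State → Bool
step3? s with input s
... | [] = false
... | x ∷ _ = ltTop x (stack2 s) ∧ gtTop x (stack1 s)

finished : State → Bool
finished (st [] [] [] _) = true
finished _ = false

stage : ℕ → State → List Op
stage n s =
  if step1? n s then [ C ]
  else if step2? n s then replicateN (length (stack1 s))
  else if step3? s then [ E ]
  else [ N ]

-- run the algorithm for at most `fuel` stages (each stage performs at least
-- one operation, and a sorting word has exactly 3n operations)
adi : ℕ → ℕ → State → List Op
adi zero n s = []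
adi (suc fuel) n s with finished s
... | true = []
... | false with run (stage n s) s
...   | nothing = []      -- stuck (cannot happen for DI-sortable inputs)
...   | just s' = stage n s ++ adi fuel n s'

ADIWord : ℕ → List ℕ → List Op
ADIWord n π = adi (3 * n) n (initial π)

at : {A : Set} → List A → ℕ → Maybe A
at [] _ = nothing
at (x ∷ _) zero = just x
at (_ ∷ xs) (suc k) = at xs k

module Submission where

-- 1. Completability.  'Completable n i s₁ s₂ k' says that the machine state with
--    input i, stacks s₁, s₂ and output 1⋯k can be finished into a sorting of
--    [n] by legal operations that keep both stacks DI.  A DI word of π makes
--    the initial state completable ('diWord⇒completable').  Each of the four kinds of ADI stage maps a
--    completable state to a completable one ('outputNext', 'flushDescent',
--    'pushPreserves', 'popPreserves'); the key obstruction is 'blocked'.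
--    Hence every stage of ADI succeeds and strictly decreases the potential μ,
--    so the fuel 3n suffices ('stageStep').
-- 3. The trace.
--    When ADI outputs v, the value v+1 is either still in the input (so
--    E_{v+1} comes later) or on top of the second stack (so C_{v+1} comes
--    next); it cannot be on the first stack ('afterOutput').

open import Defs
open import Data.Nat using (ℕ; zero; suc; _+_; _*_; _∸_; _≤_; _<_; z≤n; s≤s; _⊔_; _⊓_)
open import Data.Nat.Properties
open import Data.Bool using (Bool; true; false; _∧_; if_then_else_)
open import Data.List using (List; []; _∷_; _++_; [_]; length; take; filter; map; applyUpTo; lookup)
open import Data.List.Properties using (∷-injective; ++-assoc; ++-identityʳ; filter-all; filter-none; filter-accept; filter-reject; filter-++)
open import Data.List.Relation.Unary.All as All using (All; []; _∷_)
import Data.List.Relation.Unary.All.Properties as All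
open import Data.List.Relation.Unary.Any using (here; there)
open import Data.List.Relation.Unary.Linked as Linked using (Linked; []; [-]; _∷_)
open import Data.List.Relation.Unary.Linked.Properties using (Linked⇒All)
open import Data.List.Relation.Unary.AllPairs using ([]; _∷_)
open import Data.List.Relation.Unary.Unique.Propositional using (Unique)
open import Data.List.Relation.Binary.Permutation.Propositional using (_↭_; ↭-refl; ↭-sym; ↭-trans; ↭⇒↭ₛ)
import Data.List.Relation.Binary.Permutation.Setoid.Properties as PermutationSetoid
open import Data.List.Relation.Binary.Permutation.Propositional.Properties using (∈-resp-↭; shift; ↭-length; ++⁺ˡ)
open import Data.List.Membership.Propositional using (_∈_; _∉_)
open import Data.List.Membership.Propositional.Properties using (∈-++⁻; ∈-++⁺ˡ; ∈-++⁺ʳ; ∈-lookup)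
open import Data.List.Membership.DecPropositional _≟_ using (_∈?_; _∉?_)
open import Data.Maybe using (just)
open import Data.Product using (_×_; _,_; ∃; ∃₂; proj₁; proj₂)
open import Data.Sum using (_⊎_; inj₁; inj₂; [_,_]′)
open import Data.Empty using (⊥-elim)
open import Data.Fin using (Fin)
open import Function using (_∘_; id)
open import Relation.Binary.PropositionalEquality using (_≡_; _≢_; refl; sym; trans; cong; cong₂; subst; setoid; module ≡-Reasoning)
open import Relation.Nullary using (¬_; Dec; yes; no)
open import Relation.Nullary.Decidable using (⌊_⌋)
open import Data.Nat.Tactic.RingSolver using (solve-∀)

interval : ℕ → ℕ → List ℕ
interval a zero = []
interval a (suc c) = a ∷ interval (suc a) c

∈-interval⁻ : ∀ {x} a c → x ∈ interval a c → a ≤ x × x < a + c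
∈-interval⁻ a (suc c) (here refl) = ≤-refl , subst (a <_) (sym (+-suc a c)) (s≤s (m≤m+n a c))
∈-interval⁻ {x} a (suc c) (there p) with ∈-interval⁻ (suc a) c p
... | a<x , x<a+c = <⇒≤ a<x , subst (x <_) (sym (+-suc a c)) x<a+c

∈-interval⁺ : ∀ {x} a c → a ≤ x → x < a + c → x ∈ interval a c
∈-interval⁺ a zero a≤x x<a = ⊥-elim (<-irrefl refl (≤-trans x<a (subst (_≤ _) (sym (+-identityʳ a)) a≤x)))
∈-interval⁺ {x} a (suc c) a≤x x<a+c with a ≟ x
... | yes refl = here refl
... | no a≢x = there (∈-interval⁺ (suc a) c (≤∧≢⇒< a≤x a≢x) (subst (x <_) (+-suc a c) x<a+c))

interval-++ : ∀ a c d → interval a (c + d) ≡ interval a c ++ interval (a + c) d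
interval-++ a zero d = cong (λ b → interval b d) (sym (+-identityʳ a))
interval-++ a (suc c) d = cong (a ∷_) (trans (interval-++ (suc a) c d) (cong (λ b → interval (suc a) c ++ interval b d) (sym (+-suc a c))))

interval-∷ʳ : ∀ a c → interval a (suc c) ≡ interval a c ++ [ a + c ]
interval-∷ʳ a c = trans (cong (interval a) (+-comm 1 c)) (interval-++ a c 1)

length-interval : ∀ a c → length (interval a c) ≡ c
length-interval a zero = refl
length-interval a (suc c) = cong suc (length-interval (suc a) c)

take-interval : ∀ m a c → take m (interval a c) ≡ interval a (m ⊓ c)
take-interval zero a c = refl
take-interval (suc m) a zero = refl
take-interval (suc m) a (suc c) = cong (a ∷_) (take-interval m (suc a) c)

take-interval-≤ : ∀ {m c} a → m ≤ c → take m (interval a c) ≡ interval a m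
take-interval-≤ {m} {c} a m≤c = trans (take-interval m a c) (cong (interval a) (m≤n⇒m⊓n≡m m≤c))

unique-interval : ∀ a c → Unique (interval a c)
unique-interval a zero = []
unique-interval a (suc c) = All.tabulate (λ p a≡x → <-irrefl a≡x (proj₁ (∈-interval⁻ (suc a) c p))) ∷ unique-interval (suc a) c

interval-next : ∀ {x r} a k n → interval a k ++ x ∷ r ≡ interval a n → x ≡ a + k
interval-next a zero (suc n) refl = sym (+-identityʳ a)
interval-next a (suc k) (suc n) e = trans (interval-next (suc a) k n (proj₂ (∷-injective e))) (sym (+-suc a k))

oneTo≡interval : ∀ n → oneTo n ≡ interval 1 n
oneTo≡interval n = shifted (λ x → x) 0 n (λ _ → refl)
  where
    shifted : ∀ (f : ℕ → ℕ) a c → (∀ x → f x ≡ a + x) → map suc (applyUpTo f c) ≡ interval (suc a) c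
    shifted f a zero f≗a+ = refl
    shifted f a (suc c) f≗a+ = cong₂ _∷_ (cong suc (trans (f≗a+ 0) (+-identityʳ a)))
      (shifted (λ x → f (suc x)) (suc a) c (λ x → trans (f≗a+ (suc x)) (+-suc a x)))

length-oneTo : ∀ k → length (oneTo k) ≡ k
length-oneTo k = trans (cong length (oneTo≡interval k)) (length-interval 1 k)

oneTo-∷ʳ : ∀ k → oneTo k ++ [ suc k ] ≡ oneTo (suc k)
oneTo-∷ʳ k = trans (cong (_++ [ suc k ]) (oneTo≡interval k)) (sym (trans (oneTo≡interval (suc k)) (interval-∷ʳ 1 k)))

unique-resp-↭ : ∀ {xs ys : List ℕ} → xs ↭ ys → Unique xs → Unique ys
unique-resp-↭ p = PermutationSetoid.Unique-resp-↭ (setoid ℕ) (↭⇒↭ₛ p)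

unique-disjoint : ∀ {x : ℕ} xs {ys} → Unique (xs ++ ys) → x ∈ xs → x ∉ ys
unique-disjoint (a ∷ xs) (a∉ ∷ u) (here refl) q = All.lookup a∉ (∈-++⁺ʳ xs q) refl
unique-disjoint (a ∷ xs) (_ ∷ u) (there p) q = unique-disjoint xs u p q

unique-++ʳ : ∀ (xs : List ℕ) {ys} → Unique (xs ++ ys) → Unique ys
unique-++ʳ [] u = u
unique-++ʳ (x ∷ xs) (_ ∷ u) = unique-++ʳ xs u

at-++ : ∀ {A : Set} (L W : List A) q → at (L ++ W) (length L + q) ≡ at W q
at-++ [] W q = refl
at-++ (x ∷ L) W q = at-++ L W q

Descending : List ℕ → Set
Descending = Linked (λ a b → b < a)

Ascending : List ℕ → Set
Ascending = Linked _<_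

descending-head : ∀ {x xs} → Descending (x ∷ xs) → All (_< x) xs
descending-head [-] = []
descending-head (x>y ∷ ys) = Linked⇒All (λ p q → <-trans q p) x>y ys

ascending-head : ∀ {t T} → Ascending (t ∷ T) → All (t <_) T
ascending-head [-] = []
ascending-head (t<u ∷ us) = Linked⇒All <-trans t<u us

data Completable (n : ℕ) : List ℕ → List ℕ → List ℕ → ℕ → Set where
  done : Completable n [] [] [] n
  viaE : ∀ {x i s₁ s₂ k} → All (_< x) s₁ → Completable n i (x ∷ s₁) s₂ k → Completable n (x ∷ i) s₁ s₂ k
  viaN : ∀ {y i s₁ s₂ k} → All (y <_) s₂ → Completable n i s₁ (y ∷ s₂) k → Completable n i (y ∷ s₁) s₂ k
  viaC : ∀ {i s₁ s₂ k} → Completable n i s₁ s₂ (suc k) → Completable n i s₁ (suc k ∷ s₂) k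

∸-suc : ∀ {k n} → k < n → n ∸ k ≡ suc (n ∸ suc k)
∸-suc {zero} {suc n} _ = refl
∸-suc {suc k} {suc n} (s≤s k<n) = ∸-suc k<n

content : ∀ {n i s₁ s₂ k} → Completable n i s₁ s₂ k → k ≤ n × (i ++ s₁ ++ s₂) ↭ interval (suc k) (n ∸ k)
content {n} done = ≤-refl , subst (λ c → [] ↭ interval (suc n) c) (sym (n∸n≡0 n)) ↭-refl
content (viaE {x} {i} {s₁} {s₂} _ d) with content d
... | k≤n , p = k≤n , ↭-trans (↭-sym (shift x i (s₁ ++ s₂))) p
content (viaN {y} {i} {s₁} {s₂} _ d) with content d
... | k≤n , p = k≤n , ↭-trans (↭-sym (++⁺ˡ i (shift y s₁ s₂))) p
content {n} (viaC {i} {s₁} {s₂} {k} d) with content d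
... | k<n , p = <⇒≤ k<n ,
  ↭-trans (++⁺ˡ i (shift (suc k) s₁ s₂))
    (↭-trans (shift (suc k) i (s₁ ++ s₂))
      (subst (λ c → suc k ∷ i ++ s₁ ++ s₂ ↭ interval (suc k) c) (sym (∸-suc k<n)) (_↭_.prep (suc k) p)))

content-bounds : ∀ {n i s₁ s₂ k x} → Completable n i s₁ s₂ k → x ∈ i ++ s₁ ++ s₂ → k < x × x ≤ n
content-bounds {n} {k = k} {x} d x∈ with content d
... | k≤n , p with ∈-interval⁻ (suc k) (n ∸ k) (∈-resp-↭ p x∈)
... | k<x , x≤n = k<x , ≤-pred (subst (x <_) (cong suc (m+[n∸m]≡n k≤n)) x≤n)

content-complete : ∀ {n i s₁ s₂ k x} → Completable n i s₁ s₂ k → k < x → x ≤ n → x ∈ i ++ s₁ ++ s₂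
content-complete {n} {k = k} {x} d k<x x≤n with content d
... | k≤n , p = ∈-resp-↭ (↭-sym p) (∈-interval⁺ (suc k) (n ∸ k) k<x (subst (x <_) (sym (cong suc (m+[n∸m]≡n k≤n))) (s≤s x≤n)))

content-unique : ∀ {n i s₁ s₂ k} → Completable n i s₁ s₂ k → Unique (i ++ s₁ ++ s₂)
content-unique {n} {k = k} d = unique-resp-↭ (↭-sym (proj₂ (content d))) (unique-interval (suc k) (n ∸ k))

∈-input : ∀ {x : ℕ} {i} s₁ s₂ → x ∈ i → x ∈ i ++ s₁ ++ s₂
∈-input s₁ s₂ p = ∈-++⁺ˡ p

∈-stack1 : ∀ {x : ℕ} i {s₁} s₂ → x ∈ s₁ → x ∈ i ++ s₁ ++ s₂
∈-stack1 i s₂ p = ∈-++⁺ʳ i (∈-++⁺ˡ p)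

∈-stack2 : ∀ {x : ℕ} i s₁ {s₂} → x ∈ s₂ → x ∈ i ++ s₁ ++ s₂
∈-stack2 i s₁ p = ∈-++⁺ʳ i (∈-++⁺ʳ s₁ p)

stack1-above : ∀ {n i s₁ s₂ k} → Completable n i s₁ s₂ k → All (k <_) s₁
stack1-above {i = i} {s₂ = s₂} d = All.tabulate (λ p → proj₁ (content-bounds d (∈-stack1 i s₂ p)))

stack2-above : ∀ {n i s₁ s₂ k} → Completable n i s₁ s₂ k → All (k <_) s₂
stack2-above {i = i} {s₁ = s₁} d = All.tabulate (λ p → proj₁ (content-bounds d (∈-stack2 i s₁ p)))

stack2-ascending : ∀ {n i s₁ s₂ k} → Completable n i s₁ s₂ k → Ascending s₂
stack2-ascending done = []
stack2-ascending (viaE _ d) = stack2-ascending d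
stack2-ascending (viaN _ d) = Linked.tail (stack2-ascending d)
stack2-ascending (viaC {s₂ = []} d) = [-]
stack2-ascending (viaC {s₂ = t ∷ T} d) = All.head (stack2-above d) ∷ stack2-ascending d

outputNext : ∀ {n i s₁ s₂ k} → Completable n i s₁ (suc k ∷ s₂) k → Completable n i s₁ s₂ (suc k)
outputNext (viaE x>s₁ d) = viaE x>s₁ (outputNext d)
outputNext (viaN (y<k+1 ∷ _) d) = ⊥-elim (<-irrefl refl (≤-trans (All.head (stack2-above d)) (≤-pred y<k+1)))
outputNext (viaC d) = d

output-extends : ∀ w s {sf} → run w s ≡ just sf → ∃ λ r → output sf ≡ output s ++ r
output-extends [] s refl = [] , sym (++-identityʳ (output s))
output-extends (E ∷ w) (st (x ∷ i) s₁ s₂ o) e = output-extends w _ e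
output-extends (N ∷ w) (st i (y ∷ s₁) s₂ o) e = output-extends w _ e
output-extends (C ∷ w) (st i s₁ (x ∷ s₂) o) e with output-extends w _ e
... | r , out≡ = x ∷ r , trans out≡ (++-assoc o [ x ] r)

sorted-next : ∀ {k n x r} → (oneTo k ++ [ x ]) ++ r ≡ oneTo n → x ≡ suc k
sorted-next {k} {n} {x} {r} e = interval-next 1 k n (begin
  interval 1 k ++ x ∷ r       ≡⟨ cong (_++ x ∷ r) (sym (oneTo≡interval k)) ⟩
  oneTo k ++ [ x ] ++ r       ≡⟨ sym (++-assoc (oneTo k) [ x ] r) ⟩
  (oneTo k ++ [ x ]) ++ r     ≡⟨ e ⟩
  oneTo n                     ≡⟨ oneTo≡interval n ⟩
  interval 1 n                ∎)
  where open ≡-Reasoning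

-- each operation keeps the number of values on the machine plus the number output
size-E : ∀ a b c k → a + suc b + c + k ≡ suc a + b + c + k
size-E = solve-∀
size-N : ∀ a b c k → a + b + suc c + k ≡ a + suc b + c + k
size-N = solve-∀
size-C : ∀ a b c k → a + b + c + suc k ≡ a + b + suc c + k
size-C = solve-∀

-- A DI sorting word run from a state with output 1⋯k witnesses that this
-- state is completable (the count of values ensures it ends with everything output).
diWord⇒completable : ∀ n w s k → output s ≡ oneTo k → length (input s) + length (stack1 s) + length (stack2 s) + k ≡ n →
                     ∀ sf → run w s ≡ just sf → output sf ≡ oneTo n →
                     (∀ j → ∃ λ s' → run (take j w) s ≡ just s' × DIState s') → Completable n (input s) (stack1 s) (stack2 s) k
diWord⇒completable n [] (st i s₁ s₂ o) k refl size .(st i s₁ s₂ o) refl out≡ _ = allOutput i s₁ s₂ (+-cancelʳ-≡ k _ 0 (trans size (sym k≡n)))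
  where
    k≡n : k ≡ n
    k≡n = trans (sym (length-oneTo k)) (trans (cong length out≡) (length-oneTo n))
    allOutput : ∀ i s₁ s₂ → length i + length s₁ + length s₂ ≡ 0 → Completable n i s₁ s₂ k
    allOutput [] [] [] _ = subst (Completable n [] [] []) (sym k≡n) done
diWord⇒completable n (E ∷ w) (st (x ∷ i) s₁ s₂ o) k out≡ size sf runs sorted di with di 1
... | _ , refl , (desc , _) = viaE (descending-head desc)
  (diWord⇒completable n w _ k out≡ (trans (size-E (length i) (length s₁) (length s₂) k) size) sf runs sorted (di ∘ suc))
diWord⇒completable n (N ∷ w) (st i (y ∷ s₁) s₂ o) k out≡ size sf runs sorted di with di 1
... | _ , refl , (_ , asc) = viaN (ascending-head asc)
  (diWord⇒completable n w _ k out≡ (trans (size-N (length i) (length s₁) (length s₂) k) size) sf runs sorted (di ∘ suc))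
diWord⇒completable n (C ∷ w) (st i s₁ (x ∷ s₂) o) k refl size sf runs sorted di with output-extends w _ runs
... | r , out≡ with sorted-next {k} {n} {x} {r} (trans (sym out≡) sorted)
... | refl = viaC (diWord⇒completable n w _ (suc k) (oneTo-∷ʳ k) (trans (size-C (length i) (length s₁) (length s₂) k) size) sf runs sorted (di ∘ suc))

completable-cong : ∀ {n i i' s₁ s₁' s₂ s₂' k k'} → i ≡ i' → s₁ ≡ s₁' → s₂ ≡ s₂' → k ≡ k' →
                   Completable n i s₁ s₂ k → Completable n i' s₁' s₂' k'
completable-cong refl refl refl refl d = d

keepAbove : ℕ → List ℕ → List ℕ
keepAbove K = filter (K <?_)

-- Deleting every value ≤ K from a DI completion leaves a DI completion of the
-- remaining values (the deleted outputs are absorbed into the prefix 1⋯K).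
dropBelow : ∀ {n i s₁ s₂ k} K → K ≤ n → Completable n i s₁ s₂ k →
            Completable n (keepAbove K i) (keepAbove K s₁) (keepAbove K s₂) (k ⊔ K)
dropBelow {n} K K≤n done = subst (Completable n [] [] []) (sym (m≥n⇒m⊔n≡m K≤n)) done
dropBelow K K≤n (viaE {x} x>s₁ d) with K <? x
... | yes K<x = completable-cong (sym (filter-accept (K <?_) K<x)) refl refl refl
                  (viaE (All.filter⁺ (K <?_) x>s₁) (completable-cong refl (filter-accept (K <?_) K<x) refl refl (dropBelow K K≤n d)))
... | no K≮x = completable-cong (sym (filter-reject (K <?_) K≮x)) (filter-reject (K <?_) K≮x) refl refl (dropBelow K K≤n d)
dropBelow K K≤n (viaN {y} y<s₂ d) with K <? y
... | yes K<y = completable-cong refl (sym (filter-accept (K <?_) K<y)) refl refl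
                  (viaN (All.filter⁺ (K <?_) y<s₂) (completable-cong refl refl (filter-accept (K <?_) K<y) refl (dropBelow K K≤n d)))
... | no K≮y = completable-cong refl (sym (filter-reject (K <?_) K≮y)) (filter-reject (K <?_) K≮y) refl (dropBelow K K≤n d)
dropBelow K K≤n (viaC {k = k} d) with K <? suc k
... | yes K<k+1 = completable-cong refl refl (sym (filter-accept (K <?_) K<k+1)) (sym (m≥n⇒m⊔n≡m (≤-pred K<k+1)))
                    (viaC (completable-cong refl refl refl (m≥n⇒m⊔n≡m (m≤n⇒m≤1+n (≤-pred K<k+1))) (dropBelow K K≤n d)))
... | no K≮k+1 = completable-cong refl refl (sym (filter-reject (K <?_) K≮k+1))
                    (trans (m≤n⇒m⊔n≡n k+1≤K) (sym (m≤n⇒m⊔n≡n (<⇒≤ k+1≤K)))) (dropBelow K K≤n d)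
  where k+1≤K = ≮⇒≥ K≮k+1

data Precedes (x u : ℕ) : List ℕ → Set where
  first : ∀ {l} → u ∈ l → Precedes x u (x ∷ l)
  later : ∀ {y l} → Precedes x u l → Precedes x u (y ∷ l)

precedes-∈ : ∀ {x u l} → Precedes x u l → u ∈ l
precedes-∈ (first p) = there p
precedes-∈ (later b) = there (precedes-∈ b)

precedes-at : ∀ {x u r} Y → u ∈ r → Precedes x u (Y ++ x ∷ r)
precedes-at [] p = first p
precedes-at (_ ∷ Y) p = later (precedes-at Y p)

∈-remove : ∀ {u y : ℕ} s {r} → u ∈ s ++ y ∷ r → u ≢ y → u ∈ s ++ r
∈-remove s p u≢y with ∈-++⁻ s p
... | inj₁ q = ∈-++⁺ˡ q
... | inj₂ (here u≡y) = ⊥-elim (u≢y u≡y)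
... | inj₂ (there q) = ∈-++⁺ʳ s q

precedes-move : ∀ {x u y r} s → Precedes x u (s ++ y ∷ r) → (x ∈ s × u ≡ y) ⊎ Precedes x u (y ∷ s ++ r)
precedes-move [] b = inj₂ b
precedes-move {u = u} {y} (a ∷ s) (first p) with u ≟ y
... | yes u≡y = inj₁ (here refl , u≡y)
... | no u≢y = inj₂ (later (first (∈-remove s p u≢y)))
precedes-move (a ∷ s) (later b) with precedes-move s b
... | inj₁ (p , u≡y) = inj₁ (there p , u≡y)
... | inj₂ (first q) = inj₂ (first (there q))
... | inj₂ (later b') = inj₂ (later (later b'))

-- Let z lie on the second stack and let x ≥ z occur before
-- u < z in 'first stack, then input'.  Then u can only reach the second stack
-- after x (it cannot pass x on the DI first stack), but x can only go there
-- after z has been output, while u must be output before z.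
blocked : ∀ {n i s₁ s₂ k u z x} → Completable n i s₁ s₂ k → u < z → z ≤ x → z ∈ s₂ → ¬ Precedes x u (s₁ ++ i)
blocked done u<z z≤x () b
blocked (viaE {s₁ = s₁} y>s₁ d) u<z z≤x z∈ b with precedes-move s₁ b
... | inj₁ (x∈s₁ , refl) = <-irrefl refl (<-trans u<z (≤-<-trans z≤x (All.lookup y>s₁ x∈s₁)))
... | inj₂ b' = blocked d u<z z≤x z∈ b'
blocked (viaN y<s₂ d) u<z z≤x z∈ (first p) = <-irrefl refl (<-≤-trans (All.lookup y<s₂ z∈) z≤x)
blocked (viaN y<s₂ d) u<z z≤x z∈ (later b) = blocked d u<z z≤x (there z∈) b
blocked {i = i} {s₁ = s₁} d@(viaC _) u<z z≤x (here refl) b with ∈-++⁻ s₁ (precedes-∈ b)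
... | inj₁ p = <-irrefl refl (≤-trans (proj₁ (content-bounds d (∈-stack1 i _ p))) (≤-pred u<z))
... | inj₂ p = <-irrefl refl (≤-trans (proj₁ (content-bounds d (∈-input {i = i} s₁ _ p))) (≤-pred u<z))
blocked (viaC d) u<z z≤x (there z∈) b = blocked d u<z z≤x z∈ b

-- descent k c = k+c , … , k+1 : the first stack that step (2) of ADI flushes
descent : ℕ → ℕ → List ℕ
descent k zero = []
descent k (suc c) = suc (k + c) ∷ descent k c

length-descent : ∀ k c → length (descent k c) ≡ c
length-descent k zero = refl
length-descent k (suc c) = cong suc (length-descent k c)

∈-descent⁺ : ∀ k c {z} → k < z → z ≤ k + c → z ∈ descent k c
∈-descent⁺ k zero k<z z≤k = ⊥-elim (<-irrefl refl (<-≤-trans k<z (subst (_ ≤_) (+-identityʳ k) z≤k)))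
∈-descent⁺ k (suc c) {z} k<z z≤k+c+1 with z ≟ suc (k + c)
... | yes refl = here refl
... | no z≢ = there (∈-descent⁺ k c k<z (≤-pred (≤∧≢⇒< (subst (z ≤_) (+-suc k c) z≤k+c+1) z≢)))

∈-descent⁻ : ∀ k c {z} → z ∈ descent k c → k < z × z ≤ k + c
∈-descent⁻ k (suc c) (here refl) = s≤s (m≤m+n k c) , ≤-reflexive (sym (+-suc k c))
∈-descent⁻ k (suc c) (there p) with ∈-descent⁻ k c p
... | k<z , z≤k+c = k<z , ≤-trans z≤k+c (+-monoʳ-≤ k (n≤1+n c))

descending-count : ∀ {k h xs} → Descending xs → All (λ z → k < z × z ≤ h) xs → k ≤ h → length xs + k ≤ h
descending-count [] [] k≤h = k≤h
descending-count {k} {h} ds ((k<x@(s≤s _) , x≤h) ∷ bounds) k≤h =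
  ≤-trans (s≤s (descending-count (Linked.tail ds) (All.zipWith tighten (bounds , descending-head ds)) (≤-pred k<x))) x≤h
  where
    tighten : ∀ {z x} → (k < z × z ≤ h) × z < suc x → k < z × z ≤ x
    tighten ((k<z , _) , z<x+1) = k<z , ≤-pred z<x+1

descending-full : ∀ {k} c xs → Descending xs → length xs ≡ c → All (λ z → k < z × z ≤ k + c) xs → xs ≡ descent k c
descending-full zero [] _ _ _ = refl
descending-full {k} (suc c) (x ∷ xs) ds len ((k<x , x≤) ∷ bounds) with x ≟ suc (k + c)
... | yes refl = cong (suc (k + c) ∷_) (descending-full c xs (Linked.tail ds) (suc-injective len) (All.zipWith below (bounds , descending-head ds)))
  where
    below : ∀ {z} → (k < z × z ≤ k + suc c) × z < suc (k + c) → k < z × z ≤ k + c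
    below ((k<z , _) , z<) = k<z , ≤-pred z<
... | no x≢ = ⊥-elim (<-irrefl (+-comm c k) (subst (λ m → m + k ≤ k + c) len count))
  where
    x≤k+c : x ≤ k + c
    x≤k+c = ≤-pred (≤∧≢⇒< (subst (x ≤_) (+-suc k c) x≤) x≢)
    widen : ∀ {z} → (k < z × z ≤ k + suc c) × z ≤ x → k < z × z ≤ k + c
    widen ((k<z , _) , z≤x) = k<z , ≤-trans z≤x x≤k+c
    count : length (x ∷ xs) + k ≤ k + c
    count = descending-count ds (All.zipWith widen ((k<x , x≤) ∷ bounds , ≤-refl ∷ All.map <⇒≤ (descending-head ds))) (m≤m+n k c)

descent-or-gap : ∀ k y Y → Descending (y ∷ Y) → All (k <_) (y ∷ Y) →
                 (∃ λ c → y ∷ Y ≡ descent k (suc c)) ⊎ (∃ λ u → k < u × u < y × u ∉ y ∷ Y)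
descent-or-gap k y [] _ (k<y ∷ _) with y ≟ suc k
... | yes refl = inj₁ (0 , cong (λ z → suc z ∷ []) (sym (+-identityʳ k)))
... | no y≢ = inj₂ (suc k , ≤-refl , ≤∧≢⇒< k<y (λ e → y≢ (sym e)) , λ { (here e) → y≢ (sym e) ; (there ()) })
descent-or-gap k y (y' ∷ Y') (y'<y ∷ ds) (k<y ∷ k<Y@(k<y' ∷ _)) with suc y' ≟ y
... | yes refl with descent-or-gap k y' Y' ds k<Y
...   | inj₁ (c , refl) = inj₁ (suc c , cong (λ z → suc z ∷ suc (k + c) ∷ descent k c) (sym (+-suc k c)))
...   | inj₂ (u , k<u , u<y' , u∉) = inj₂ (u , k<u , <-trans u<y' (n<1+n y') ,
          λ { (here e) → <-irrefl e (<-trans u<y' (n<1+n y')) ; (there p) → u∉ p })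
descent-or-gap k y (y' ∷ Y') (y'<y ∷ ds) (k<y ∷ k<Y@(k<y' ∷ _)) | no y'+1≢y =
  inj₂ (suc y' , <-trans k<y' (n<1+n y') , ≤∧≢⇒< y'<y y'+1≢y ,
        λ { (here e) → y'+1≢y e ; (there (here e)) → <-irrefl (sym e) (n<1+n y') ;
            (there (there p)) → <-irrefl refl (<-trans (n<1+n y') (All.lookup (descending-head ds) p)) })

pourOnto : List ℕ → List ℕ → List ℕ
pourOnto [] s₂ = s₂
pourOnto (x ∷ xs) s₂ = pourOnto xs (x ∷ s₂)

length-pourOnto : ∀ xs s₂ → length (pourOnto xs s₂) ≡ length xs + length s₂
length-pourOnto [] s₂ = refl
length-pourOnto (x ∷ xs) s₂ = trans (length-pourOnto xs (x ∷ s₂)) (+-suc (length xs) (length s₂))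

pourOnto-descent : ∀ k c s₂ → pourOnto (descent k c) s₂ ≡ interval (suc k) c ++ s₂
pourOnto-descent k zero s₂ = refl
pourOnto-descent k (suc c) s₂ = begin
  pourOnto (descent k c) (suc (k + c) ∷ s₂)   ≡⟨ pourOnto-descent k c (suc (k + c) ∷ s₂) ⟩
  interval (suc k) c ++ [ suc k + c ] ++ s₂   ≡⟨ sym (++-assoc (interval (suc k) c) [ suc (k + c) ] s₂) ⟩
  (interval (suc k) c ++ [ suc k + c ]) ++ s₂ ≡⟨ cong (_++ s₂) (sym (interval-∷ʳ (suc k) c)) ⟩
  interval (suc k) (suc c) ++ s₂              ∎
  where open ≡-Reasoning

prependOutputs : ∀ {n i s₂} k c → Completable n i [] s₂ (k + c) → Completable n i [] (interval (suc k) c ++ s₂) k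
prependOutputs {n} {i} {s₂} k zero d = subst (Completable n i [] s₂) (+-identityʳ k) d
prependOutputs {n} {i} {s₂} k (suc c) d = viaC (prependOutputs (suc k) c (subst (Completable n i [] s₂) (+-suc k c) d))

-- The completion of the rest is
-- obtained from the given one by deleting the values ≤ k+c.
flushDescent : ∀ {n i s₂ k} c → Completable n i (descent k c) s₂ k → k + c ≤ n →
               Completable n i [] (pourOnto (descent k c) s₂) k
flushDescent {n} {i} {s₂} {k} c d k+c≤n =
  subst (λ l → Completable n i [] l k) (sym (pourOnto-descent k c s₂)) (prependOutputs k c rest)
  where
    K = k + c
    u = content-unique d
    outsideDescent : ∀ {z} → z ∈ descent k c → ¬ K < z
    outsideDescent p K<z = <-irrefl refl (<-≤-trans K<z (proj₂ (∈-descent⁻ k c p)))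
    input-large : All (K <_) i
    input-large = All.tabulate (λ p → ≰⇒> (λ z≤K → unique-disjoint i u p
      (∈-++⁺ˡ (∈-descent⁺ k c (proj₁ (content-bounds d (∈-input {i = i} (descent k c) s₂ p))) z≤K))))
    stack2-large : All (K <_) s₂
    stack2-large = All.tabulate (λ p → ≰⇒> (λ z≤K → unique-disjoint (descent k c) (unique-++ʳ i u)
      (∈-descent⁺ k c (proj₁ (content-bounds d (∈-stack2 i (descent k c) p))) z≤K) p))
    dropped : Completable n (keepAbove K i) (keepAbove K (descent k c)) (keepAbove K s₂) (k ⊔ K)
    dropped = dropBelow K k+c≤n d
    rest : Completable n i [] s₂ (k + c)
    rest = completable-cong (filter-all (K <?_) input-large) (filter-none (K <?_) (All.tabulate outsideDescent))
             (filter-all (K <?_) stack2-large) (m≤n⇒m⊔n≡n (m≤m+n k c)) (dropBelow K k+c≤n d)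

-- Step (3) of ADI: when neither step (1) nor step (2) applies and the next
-- input entry x fits on top of the first stack, entering it keeps
-- completability.  Otherwise a completion would start with N_y for the top y
-- of the first stack; a value u < y missing from that stack is then either
-- on the second stack (too small to lie under y) or behind x in the input
-- (blocked by y ≤ x).
pushPreserves : ∀ {n x r s₁ s₂ k} → Completable n (x ∷ r) s₁ s₂ k → Descending s₁ → (∀ T → s₂ ≢ suc k ∷ T) →
                (∀ c → s₁ ≢ descent k (suc c)) → All (_< x) s₁ → Completable n r (x ∷ s₁) s₂ k
pushPreserves (viaE _ d) _ _ _ _ = d
pushPreserves (viaC d) _ notNext _ _ = ⊥-elim (notNext _ refl)
pushPreserves {n} {x} {r} {y ∷ Y} {s₂} {k} d₀@(viaN y<s₂ d) ds _ notFull s₁<x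
  with descent-or-gap k y Y ds (stack1-above d₀)
... | inj₁ (c , full) = ⊥-elim (notFull c full)
... | inj₂ (u , k<u , u<y , u∉) with ∈-++⁻ (x ∷ r) (content-complete d₀ k<u (≤-trans (<⇒≤ u<y) (proj₂ (content-bounds d₀ (∈-stack1 (x ∷ r) s₂ (here refl))))))
... | inj₁ (here refl) = ⊥-elim (<-irrefl refl (<-trans u<y (All.head s₁<x)))
... | inj₁ (there u∈r) = ⊥-elim (blocked d u<y (<⇒≤ (All.head s₁<x)) (here refl) (precedes-at Y u∈r))
... | inj₂ u∈stacks with ∈-++⁻ (y ∷ Y) u∈stacks
... | inj₁ u∈s₁ = ⊥-elim (u∉ u∈s₁)
... | inj₂ u∈s₂ = ⊥-elim (<-irrefl refl (<-trans u<y (All.lookup y<s₂ u∈s₂)))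

-- The hypothesis 'tooBig' records why step
-- (3) failed: an input entry above the first stack is not below the second.
-- A completion starting with E_x would leave k+1 (which is not on top of the
-- second stack) stuck behind x, blocked by the top t ≤ x of the second stack.
popPreserves : ∀ {n i s₁ s₂ k} → Completable n i s₁ s₂ k → ¬ (i ≡ [] × s₁ ≡ [] × s₂ ≡ []) → (∀ T → s₂ ≢ suc k ∷ T) →
               (∀ x r → i ≡ x ∷ r → All (_< x) s₁ → ∃₂ λ t T → s₂ ≡ t ∷ T × t ≤ x) →
               ∃₂ λ y Y → s₁ ≡ y ∷ Y × Completable n i Y (y ∷ s₂) k
popPreserves done notDone _ _ = ⊥-elim (notDone (refl , refl , refl))
popPreserves (viaN _ d) _ _ _ = _ , _ , refl , d
popPreserves (viaC d) _ notNext _ = ⊥-elim (notNext _ refl)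
popPreserves {n} {x ∷ r} {s₁} {s₂} {k} d₀@(viaE s₁<x d) _ notNext tooBig with tooBig x r refl s₁<x
... | t , T , refl , t≤x with ≤∧≢⇒< (All.head (stack2-above d₀)) (λ e → notNext T (cong (_∷ T) (sym e)))
... | k+1<t with ∈-++⁻ (x ∷ r) (content-complete d₀ (n<1+n k) (≤-trans (<⇒≤ k+1<t) (proj₂ (content-bounds d₀ (∈-stack2 (x ∷ r) s₁ (here refl))))))
... | inj₁ (here refl) = ⊥-elim (<-irrefl refl (<-≤-trans k+1<t t≤x))
... | inj₁ (there p) = ⊥-elim (blocked d k+1<t t≤x (here refl) (first (∈-++⁺ʳ s₁ p)))
... | inj₂ q with ∈-++⁻ s₁ q
... | inj₁ p = ⊥-elim (blocked d k+1<t t≤x (here refl) (first (∈-++⁺ˡ p)))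
... | inj₂ (here refl) = ⊥-elim (<-irrefl refl k+1<t)
... | inj₂ (there p) = ⊥-elim (<-irrefl refl (<-trans k+1<t (All.lookup (ascending-head (stack2-ascending d₀)) p)))

isYes-sound : ∀ {P : Set} (d : Dec P) → ⌊ d ⌋ ≡ true → P
isYes-sound (yes p) _ = p

isYes-complete : ∀ {P : Set} (d : Dec P) → P → ⌊ d ⌋ ≡ true
isYes-complete (yes _) _ = refl
isYes-complete (no ¬p) p = ⊥-elim (¬p p)

∧-true : ∀ {a b} → a ∧ b ≡ true → a ≡ true × b ≡ true
∧-true {true} {true} _ = refl , refl

∧-false : ∀ {b} → b ∧ true ≡ false → b ≡ false
∧-false {false} _ = refl

true≢false : true ≢ false
true≢false ()

allB-sound : ∀ p xs → allB p xs ≡ true → ∀ {x} → x ∈ xs → p x ≡ true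
allB-sound p (y ∷ xs) e (here refl) = proj₁ (∧-true {p y} e)
allB-sound p (y ∷ xs) e (there q) = allB-sound p xs (proj₂ (∧-true {p y} e)) q

allB-complete : ∀ p xs → (∀ {x} → x ∈ xs → p x ≡ true) → allB p xs ≡ true
allB-complete p [] h = refl
allB-complete p (y ∷ xs) h rewrite h (here refl) = allB-complete p xs (λ q → h (there q))

notOutput-interval : ∀ n k i s₁ s₂ → k ≤ n → notOutput n (st i s₁ s₂ (oneTo k)) ≡ interval (suc k) (n ∸ k)
notOutput-interval n k i s₁ s₂ k≤n = begin
  filter (_∉? oneTo k) (oneTo n)
    ≡⟨ cong (filter (_∉? oneTo k)) (trans (oneTo≡interval n) (trans (cong (interval 1) (sym (m+[n∸m]≡n k≤n))) (interval-++ 1 k (n ∸ k)))) ⟩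
  filter (_∉? oneTo k) (interval 1 k ++ interval (suc k) (n ∸ k))
    ≡⟨ filter-++ (_∉? oneTo k) (interval 1 k) (interval (suc k) (n ∸ k)) ⟩
  filter (_∉? oneTo k) (interval 1 k) ++ filter (_∉? oneTo k) (interval (suc k) (n ∸ k))
    ≡⟨ cong₂ _++_ (filter-none (_∉? oneTo k) (All.tabulate alreadyOutput)) (filter-all (_∉? oneTo k) (All.tabulate notYetOutput)) ⟩
  interval (suc k) (n ∸ k) ∎
  where
    open ≡-Reasoning
    alreadyOutput : ∀ {x} → x ∈ interval 1 k → ¬ (x ∉ oneTo k)
    alreadyOutput p x∉ = x∉ (subst (_ ∈_) (sym (oneTo≡interval k)) p)
    notYetOutput : ∀ {x} → x ∈ interval (suc k) (n ∸ k) → x ∉ oneTo k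
    notYetOutput p q = <-irrefl refl (<-≤-trans (proj₂ (∈-interval⁻ 1 k (subst (_ ∈_) (oneTo≡interval k) q)))
                                                (proj₁ (∈-interval⁻ (suc k) (n ∸ k) p)))

topIsNext : List ℕ → List ℕ → Bool
topIsNext (x ∷ _) (v ∷ _) = ⌊ x ≟ v ⌋
topIsNext _ _ = false

step1?-unfold : ∀ n s → step1? n s ≡ topIsNext (stack2 s) (notOutput n s)
step1?-unfold n s with stack2 s | notOutput n s
... | [] | _ = refl
... | _ ∷ _ | [] = refl
... | _ ∷ _ | _ ∷ _ = refl

topIsNext-sound : ∀ {x T a c} → topIsNext (x ∷ T) (interval a c) ≡ true → x ≡ a
topIsNext-sound {x} {T} {a} {suc c} e = isYes-sound (x ≟ a) e

topIsNext-complete : ∀ {T a c} → 0 < c → topIsNext (a ∷ T) (interval a c) ≡ true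
topIsNext-complete {T} {a} {suc c} _ = isYes-complete (a ≟ a) refl

isNextBlock : List ℕ → List ℕ → Bool
isNextBlock [] _ = false
isNextBlock s₁@(_ ∷ _) nO = ⌊ length (take (length s₁) nO) ≟ length s₁ ⌋ ∧ allB (λ x → ⌊ x ∈? take (length s₁) nO ⌋) s₁

step2?-unfold : ∀ n s → step2? n s ≡ isNextBlock (stack1 s) (notOutput n s)
step2?-unfold n s with stack1 s
... | [] = refl
... | _ ∷ _ = refl

isNextBlock-sound : ∀ {k c} y Y → Descending (y ∷ Y) → isNextBlock (y ∷ Y) (interval (suc k) c) ≡ true →
                    length (y ∷ Y) ≤ c × y ∷ Y ≡ descent k (length (y ∷ Y))
isNextBlock-sound {k} {c} y Y ds e = m≤c , descending-full m (y ∷ Y) ds refl (All.tabulate bounds)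
  where
    m = length (y ∷ Y)
    guards = ∧-true {⌊ length (take m (interval (suc k) c)) ≟ m ⌋} e
    m⊓c≡m : m ⊓ c ≡ m
    m⊓c≡m = trans (sym (trans (cong length (take-interval m (suc k) c)) (length-interval (suc k) (m ⊓ c))))
                  (isYes-sound (length (take m (interval (suc k) c)) ≟ m) (proj₁ guards))
    m≤c : m ≤ c
    m≤c = m⊓n≡m⇒m≤n m⊓c≡m
    bounds : ∀ {x} → x ∈ y ∷ Y → k < x × x ≤ k + m
    bounds {x} p with ∈-interval⁻ (suc k) (m ⊓ c) (subst (x ∈_) (take-interval m (suc k) c)
                        (isYes-sound (x ∈? take m (interval (suc k) c)) (allB-sound _ (y ∷ Y) (proj₂ guards) p)))
    ... | k<x , x≤ = k<x , ≤-pred (subst (λ z → x < suc k + z) m⊓c≡m x≤)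

isNextBlock-complete : ∀ {a d} y Y → length (y ∷ Y) ≤ d → (∀ {x} → x ∈ y ∷ Y → x ∈ interval a (length (y ∷ Y))) →
                       isNextBlock (y ∷ Y) (interval a d) ≡ true
isNextBlock-complete {a} {d} y Y m≤d inside = cong₂ _∧_ lengthOK membersOK
  where
    m = length (y ∷ Y)
    takeEq = take-interval-≤ a m≤d
    lengthOK : ⌊ length (take m (interval a d)) ≟ m ⌋ ≡ true
    lengthOK = isYes-complete (_ ≟ m) (trans (cong length takeEq) (length-interval a m))
    membersOK : allB (λ x → ⌊ x ∈? take m (interval a d) ⌋) (y ∷ Y) ≡ true
    membersOK = allB-complete _ (y ∷ Y) (λ {x} p → isYes-complete (x ∈? _) (subst (x ∈_) (sym takeEq) (inside p)))

descent-isNextBlock : ∀ {k c d} → suc c ≤ d → isNextBlock (descent k (suc c)) (interval (suc k) d) ≡ true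
descent-isNextBlock {k} {c} {d} c<d = isNextBlock-complete _ (descent k c) (subst (_≤ d) (sym len) c<d) inside
  where
    len = length-descent k (suc c)
    inside : ∀ {x} → x ∈ descent k (suc c) → x ∈ interval (suc k) (length (descent k (suc c)))
    inside {x} p with ∈-descent⁻ k (suc c) p
    ... | k<x , x≤ = subst (λ m → x ∈ interval (suc k) m) (sym len) (∈-interval⁺ (suc k) (suc c) k<x (s≤s x≤))

gtTop-sound : ∀ {x s₁} → Descending s₁ → gtTop x s₁ ≡ true → All (_< x) s₁
gtTop-sound {x} {[]} _ _ = []
gtTop-sound {x} {y ∷ Y} ds e = y<x ∷ All.map (λ q → <-trans q y<x) (descending-head ds)
  where y<x = isYes-sound (y <? x) e

gtTop-complete : ∀ {x s₁} → All (_< x) s₁ → gtTop x s₁ ≡ true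
gtTop-complete {x} {[]} _ = refl
gtTop-complete {x} {y ∷ Y} (y<x ∷ _) = isYes-complete (y <? x) y<x

gtTop-descending : ∀ {x s₁} → gtTop x s₁ ≡ true → Descending s₁ → Descending (x ∷ s₁)
gtTop-descending {x} {[]} _ _ = [-]
gtTop-descending {x} {y ∷ Y} e ds = isYes-sound (y <? x) e ∷ ds

ltTop-sound : ∀ {x s₂} → Ascending s₂ → ltTop x s₂ ≡ true → All (x <_) s₂
ltTop-sound {x} {[]} _ _ = []
ltTop-sound {x} {t ∷ T} as e = x<t ∷ All.map (λ q → <-trans x<t q) (ascending-head as)
  where x<t = isYes-sound (x <? t) e

ltTop-false : ∀ {x s₂} → ltTop x s₂ ≡ false → ∃₂ λ t T → s₂ ≡ t ∷ T × t ≤ x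
ltTop-false {x} {t ∷ T} e with x <? t
... | yes _ = ⊥-elim (true≢false e)
... | no x≮t = t , T , refl , ≮⇒≥ x≮t

-- the potential decreasing at each stage of ADI: an entry costs 3 in the
-- input, 2 on the first stack and 1 on the second stack
μ : State → ℕ
μ s = length (stack2 s) + 2 * length (stack1 s) + 3 * length (input s)

record Invariant (n : ℕ) (s : State) (k : ℕ) : Set where
  constructor invariant
  field
    output≡      : output s ≡ oneTo k
    completable  : Completable n (input s) (stack1 s) (stack2 s) k
    descending   : Descending (stack1 s)
    stack1<stack2 : All (λ a → All (a <_) (stack2 s)) (stack1 s)

OutputStage : ℕ → State → List Op → State → ℕ → Set
OutputStage k s ops s' k' = k' ≡ suc k × labelled ops s ≡ [ (C , suc k) ] ×
  input s' ≡ input s × stack1 s' ≡ stack1 s × stack2 s ≡ suc k ∷ stack2 s'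

QuietStage : ℕ → State → List Op → State → ℕ → Set
QuietStage k s ops s' k' = k' ≡ k × (∀ T → stack2 s ≢ suc k ∷ T) ×
  ((∃ λ y → input s ≡ y ∷ input s' × labelled ops s ≡ [ (E , y) ]) ⊎ input s' ≡ input s)

record Stage (n k : ℕ) (s : State) : Set where
  constructor stage-result
  field
    ops      : List Op
    next     : State
    nextK    : ℕ
    stage≡   : stage n s ≡ ops
    runs     : run ops s ≡ just next
    keeps    : Invariant n next nextK
    decrease : μ next < μ s
    kind     : OutputStage k s ops next nextK ⊎ QuietStage k s ops next nextK

selectStage : Bool → Bool → Bool → ℕ → List Op
selectStage b₁ b₂ b₃ m = if b₁ then [ C ] else if b₂ then replicateN m else if b₃ then [ E ] else [ N ]

stage≡select : ∀ n s {b₁ b₂ b₃} → step1? n s ≡ b₁ → step2? n s ≡ b₂ → step3? s ≡ b₃ →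
               stage n s ≡ selectStage b₁ b₂ b₃ (length (stack1 s))
stage≡select n s refl refl refl = refl

run-pour : ∀ {i o} xs s₂ → run (replicateN (length xs)) (st i xs s₂ o) ≡ just (st i [] (pourOnto xs s₂) o)
run-pour [] s₂ = refl
run-pour (x ∷ xs) s₂ = run-pour xs (x ∷ s₂)

μ-flush : ∀ a c b → suc ((suc c + a) + 2 * 0 + 3 * b) ≤ a + 2 * suc c + 3 * b
μ-flush a c b = subst (suc ((suc c + a) + 2 * 0 + 3 * b) ≤_) (sym (eq a c b)) (m≤m+n _ c)
  where eq : ∀ a c b → a + 2 * suc c + 3 * b ≡ suc ((suc c + a) + 2 * 0 + 3 * b) + c
        eq = solve-∀

μ-enter : ∀ a c b → suc (a + 2 * suc c + 3 * b) ≡ a + 2 * c + 3 * suc b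
μ-enter = solve-∀

μ-move : ∀ a c b → suc (suc a + 2 * c + 3 * b) ≡ a + 2 * suc c + 3 * b
μ-move = solve-∀

module Guards {n k i s₁ s₂} (g : Invariant n (st i s₁ s₂ (oneTo k)) k) where
  private
    d = Invariant.completable g
    k≤n = proj₁ (content d)
    s = st i s₁ s₂ (oneTo k)

  step1?≡ : step1? n s ≡ topIsNext s₂ (interval (suc k) (n ∸ k))
  step1?≡ = trans (step1?-unfold n s) (cong (topIsNext s₂) (notOutput-interval n k i s₁ s₂ k≤n))

  step2?≡ : step2? n s ≡ isNextBlock s₁ (interval (suc k) (n ∸ k))
  step2?≡ = trans (step2?-unfold n s) (cong (isNextBlock s₁) (notOutput-interval n k i s₁ s₂ k≤n))

  notNext : step1? n s ≡ false → ∀ T → s₂ ≢ suc k ∷ T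
  notNext e T refl = true≢false (trans (sym (topIsNext-complete {T} {suc k} {n ∸ k} k<n∸k)) (trans (sym step1?≡) e))
    where k<n∸k = m<n⇒0<n∸m (proj₂ (content-bounds d (∈-stack2 i s₁ (here refl))))

  notFull : step2? n s ≡ false → ∀ c → s₁ ≢ descent k (suc c)
  notFull e c refl = true≢false (trans (sym (descent-isNextBlock {k} {c} {n ∸ k} c<n∸k)) (trans (sym step2?≡) e))
    where
      k+c<n = proj₂ (content-bounds d (∈-stack1 i s₂ (here refl)))
      c<n∸k = +-cancelˡ-≤ k _ _ (subst (k + suc c ≤_) (sym (m+[n∸m]≡n k≤n)) (subst (_≤ n) (sym (+-suc k c)) k+c<n))

outputStage : ∀ {n k i s₁ s₂} → Invariant n (st i s₁ s₂ (oneTo k)) k → step1? n (st i s₁ s₂ (oneTo k)) ≡ true →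
              Stage n k (st i s₁ s₂ (oneTo k))
outputStage {n} {k} {i} {s₁} {s₂} g e₁ = fromTop s₂ refl (trans (sym (Guards.step1?≡ g)) e₁)
  where
    fromTop : ∀ s₂' → s₂' ≡ s₂ → topIsNext s₂' (interval (suc k) (n ∸ k)) ≡ true → Stage n k (st i s₁ s₂ (oneTo k))
    fromTop (x ∷ T) refl e with topIsNext-sound {c = n ∸ k} e
    ... | refl = stage-result [ C ] (st i s₁ T (oneTo k ++ [ suc k ])) (suc k) (stage≡select n (st i s₁ (x ∷ T) (oneTo k)) e₁ refl refl) refl
      (invariant (oneTo-∷ʳ k) (outputNext (Invariant.completable g)) (Invariant.descending g) (All.map All.tail (Invariant.stack1<stack2 g)))
      ≤-refl (inj₁ (refl , refl , refl , refl , refl))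

pourStage : ∀ {n k i s₁ s₂} c → s₁ ≡ descent k (suc c) → suc c ≤ n ∸ k → (g : Invariant n (st i s₁ s₂ (oneTo k)) k) →
            step1? n (st i s₁ s₂ (oneTo k)) ≡ false → step2? n (st i s₁ s₂ (oneTo k)) ≡ true → Stage n k (st i s₁ s₂ (oneTo k))
pourStage {n} {k} {i} {_} {s₂} c refl c<n∸k g e₁ e₂ =
  stage-result _ (st i [] (pourOnto (descent k (suc c)) s₂) (oneTo k)) k (stage≡select n (st i (descent k (suc c)) s₂ (oneTo k)) e₁ e₂ refl)
    (run-pour (descent k (suc c)) s₂) (invariant refl (flushDescent (suc c) d k+c<n) [] []) decrease (inj₂ (refl , Guards.notNext g e₁ , inj₂ refl))
  where
    d = Invariant.completable g
    k+c<n : k + suc c ≤ n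
    k+c<n = subst (k + suc c ≤_) (m+[n∸m]≡n (proj₁ (content d))) (+-monoʳ-≤ k c<n∸k)
    decrease : μ (st i [] (pourOnto (descent k (suc c)) s₂) (oneTo k)) < μ (st i (descent k (suc c)) s₂ (oneTo k))
    decrease rewrite length-pourOnto (descent k (suc c)) s₂ | length-descent k c = μ-flush (length s₂) c (length i)

flushStage : ∀ {n k i s₁ s₂} (g : Invariant n (st i s₁ s₂ (oneTo k)) k) →
             step1? n (st i s₁ s₂ (oneTo k)) ≡ false → step2? n (st i s₁ s₂ (oneTo k)) ≡ true → Stage n k (st i s₁ s₂ (oneTo k))
flushStage {n} {k} {i} {s₁} {s₂} g e₁ e₂ = fromBlock s₁ refl (trans (sym (Guards.step2?≡ g)) e₂)
  where
    fromBlock : ∀ s₁' → s₁' ≡ s₁ → isNextBlock s₁' (interval (suc k) (n ∸ k)) ≡ true → Stage n k (st i s₁ s₂ (oneTo k))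
    fromBlock (y ∷ Y) refl e with isNextBlock-sound {k} {n ∸ k} y Y (Invariant.descending g) e
    ... | c<n∸k , block = pourStage (length Y) block c<n∸k g e₁ e₂

enterStage : ∀ {n k x r s₁ s₂} (g : Invariant n (st (x ∷ r) s₁ s₂ (oneTo k)) k) →
             step1? n (st (x ∷ r) s₁ s₂ (oneTo k)) ≡ false → step2? n (st (x ∷ r) s₁ s₂ (oneTo k)) ≡ false →
             ltTop x s₂ ∧ gtTop x s₁ ≡ true → Stage n k (st (x ∷ r) s₁ s₂ (oneTo k))
enterStage {n} {k} {x} {r} {s₁} {s₂} g e₁ e₂ e₃ =
  stage-result [ E ] (st r (x ∷ s₁) s₂ (oneTo k)) k (stage≡select n (st (x ∷ r) s₁ s₂ (oneTo k)) e₁ e₂ e₃) refl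
    (invariant refl (pushPreserves d ds (Guards.notNext g e₁) (Guards.notFull g e₂) (gtTop-sound ds above))
      (gtTop-descending above ds) (ltTop-sound (stack2-ascending d) below ∷ Invariant.stack1<stack2 g))
    (≤-reflexive (μ-enter (length s₂) (length s₁) (length r))) (inj₂ (refl , Guards.notNext g e₁ , inj₁ (x , refl , refl)))
  where
    d = Invariant.completable g
    ds = Invariant.descending g
    below = proj₁ (∧-true {ltTop x s₂} e₃)
    above = proj₂ (∧-true {ltTop x s₂} e₃)

moveStage : ∀ {n k i s₁ s₂} (g : Invariant n (st i s₁ s₂ (oneTo k)) k) → step1? n (st i s₁ s₂ (oneTo k)) ≡ false →
            stage n (st i s₁ s₂ (oneTo k)) ≡ [ N ] → (∃₂ λ y Y → s₁ ≡ y ∷ Y × Completable n i Y (y ∷ s₂) k) →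
            Stage n k (st i s₁ s₂ (oneTo k))
moveStage {n} {k} {i} {_} {s₂} g e₁ stage≡N (y , Y , refl , d') =
  stage-result [ N ] (st i Y (y ∷ s₂) (oneTo k)) k stage≡N refl
    (invariant refl d' (Linked.tail ds) (All.zipWith (λ { (y>a , a<s₂) → y>a ∷ a<s₂ }) (descending-head ds , All.tail (Invariant.stack1<stack2 g))))
    (≤-reflexive (μ-move (length s₂) (length Y) (length i))) (inj₂ (refl , Guards.notNext g e₁ , inj₂ refl))
  where ds = Invariant.descending g

stageStep : ∀ {n k} s → Invariant n s k → finished s ≡ false → Stage n k s
stageStep {n} {k} (st i s₁ s₂ o) g@(invariant refl _ _ _) _ with step1? n (st i s₁ s₂ (oneTo k)) in e₁
... | true = outputStage g e₁
... | false with step2? n (st i s₁ s₂ (oneTo k)) in e₂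
... | true = flushStage g e₁ e₂
stageStep {n} {k} (st (x ∷ r) s₁ s₂ o) g@(invariant refl d _ _) _ | false | false with ltTop x s₂ ∧ gtTop x s₁ in e₃
... | true = enterStage g e₁ e₂ e₃
... | false = moveStage g e₁ (stage≡select n (st (x ∷ r) s₁ s₂ (oneTo k)) e₁ e₂ e₃)
                (popPreserves d (λ { (() , _) }) (Guards.notNext g e₁) secondTooSmall)
  where
    secondTooSmall : ∀ x' r' → x ∷ r ≡ x' ∷ r' → All (_< x') s₁ → ∃₂ λ t T → s₂ ≡ t ∷ T × t ≤ x'
    secondTooSmall x' r' refl s₁<x = ltTop-false (∧-false (subst (λ b → ltTop x s₂ ∧ b ≡ false) (gtTop-complete s₁<x) e₃))
stageStep {n} {k} (st [] s₁ s₂ o) g@(invariant refl d _ _) unfinished | false | false =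
  moveStage g e₁ (stage≡select n (st [] s₁ s₂ (oneTo k)) e₁ e₂ refl) (popPreserves d notDone (Guards.notNext g e₁) (λ _ _ ()))
  where
    notDone : ¬ ([] ≡ [] × s₁ ≡ [] × s₂ ≡ [])
    notDone (refl , refl , refl) = true≢false unfinished

trace : ℕ → ℕ → State → List (Op × ℕ)
trace f n s = labelled (adi f n s) s

onMachine : State → List ℕ
onMachine s = input s ++ stack1 s ++ stack2 s

unfinished : ∀ s {x} → x ∈ onMachine s → finished s ≡ false
unfinished (st (_ ∷ _) s₁ s₂ o) _ = refl
unfinished (st [] (_ ∷ _) s₂ o) _ = refl
unfinished (st [] [] (_ ∷ _) o) _ = refl

μ-positive : ∀ s {x} → x ∈ onMachine s → 0 < μ s
μ-positive (st i s₁ (_ ∷ _) o) _ = s≤s z≤n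
μ-positive (st i (_ ∷ _) [] o) _ = s≤s z≤n
μ-positive (st (_ ∷ _) [] [] o) _ = s≤s z≤n

noFuel : ∀ s {x} → x ∈ onMachine s → ¬ μ s ≤ 0
noFuel s x∈ μ≤0 = <-irrefl refl (<-≤-trans (μ-positive s x∈) μ≤0)

labelled-++ : ∀ xs ys s s' → run xs s ≡ just s' → labelled (xs ++ ys) s ≡ labelled xs s ++ labelled ys s'
labelled-++ [] ys s .s refl = refl
labelled-++ (o ∷ xs) ys s s' e with step o s
... | just (s'' , j) = cong ((o , j) ∷_) (labelled-++ xs ys s'' s' e)

trace-unfold : ∀ {n k} f s (r : Stage n k s) → finished s ≡ false →
               trace (suc f) n s ≡ labelled (Stage.ops r) s ++ trace f n (Stage.next r)
trace-unfold {n} f s r unfin = begin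
  labelled (adi (suc f) n s) s                           ≡⟨ cong (λ w → labelled w s) adi≡ ⟩
  labelled (Stage.ops r ++ adi f n (Stage.next r)) s     ≡⟨ labelled-++ (Stage.ops r) _ s _ (Stage.runs r) ⟩
  labelled (Stage.ops r) s ++ trace f n (Stage.next r)   ∎
  where
    open ≡-Reasoning
    stageRuns : run (stage n s) s ≡ just (Stage.next r)
    stageRuns = subst (λ w → run w s ≡ just (Stage.next r)) (sym (Stage.stage≡ r)) (Stage.runs r)
    adi≡ : adi (suc f) n s ≡ Stage.ops r ++ adi f n (Stage.next r)
    adi≡ rewrite unfin | stageRuns = cong (_++ adi f n (Stage.next r)) (Stage.stage≡ r)

fuelLeft : ∀ {n k s f} (r : Stage n k s) → μ s ≤ suc f → μ (Stage.next r) ≤ f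
fuelLeft r μ≤ = ≤-pred (≤-trans (Stage.decrease r) μ≤)

Occurs : List (Op × ℕ) → Op × ℕ → Set
Occurs W a = ∃ λ q → at W q ≡ just a

occurs-++ : ∀ L {W a} → Occurs W a → Occurs (L ++ W) a
occurs-++ L {W} (q , at≡) = length L + q , trans (at-++ L W q) at≡

trace-enters : ∀ f {n k} s → Invariant n s k → μ s ≤ f → ∀ {x} → x ∈ input s → Occurs (trace f n s) (E , x)
trace-enters zero s g μ≤ x∈ = ⊥-elim (noFuel s (∈-++⁺ˡ x∈) μ≤)
trace-enters (suc f) {n} s g μ≤ {x} x∈ with stageStep s g (unfinished s (∈-++⁺ˡ x∈))
... | r rewrite trace-unfold f s r (unfinished s (∈-++⁺ˡ x∈)) with Stage.kind r
... | inj₁ (_ , _ , input≡ , _) = occurs-++ (labelled (Stage.ops r) s) (trace-enters f (Stage.next r) (Stage.keeps r) (fuelLeft r μ≤) (subst (x ∈_) (sym input≡) x∈))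
... | inj₂ (_ , _ , inj₂ input≡) = occurs-++ (labelled (Stage.ops r) s) (trace-enters f (Stage.next r) (Stage.keeps r) (fuelLeft r μ≤) (subst (x ∈_) (sym input≡) x∈))
... | inj₂ (_ , _ , inj₁ (y , input≡ , lab)) with subst (x ∈_) input≡ x∈
...   | here refl = 0 , cong (λ L → at (L ++ _) 0) lab
...   | there x∈' = occurs-++ (labelled (Stage.ops r) s) (trace-enters f (Stage.next r) (Stage.keeps r) (fuelLeft r μ≤) x∈')

trace-outputsNext : ∀ f {n k T} s → Invariant n s k → stack2 s ≡ suc k ∷ T → μ s ≤ f → at (trace f n s) 0 ≡ just (C , suc k)
trace-outputsNext f {n} {k} {T} s g s₂≡ μ≤ = go f μ≤
  where
    onTop : suc k ∈ onMachine s
    onTop = ∈-stack2 (input s) (stack1 s) (subst (suc k ∈_) (sym s₂≡) (here refl))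
    go : ∀ f → μ s ≤ f → at (trace f n s) 0 ≡ just (C , suc k)
    go zero μ≤0 = ⊥-elim (noFuel s onTop μ≤0)
    go (suc f) _ with stageStep s g (unfinished s onTop)
    ... | r rewrite trace-unfold f s r (unfinished s onTop) with Stage.kind r
    ... | inj₂ (_ , notNext , _) = ⊥-elim (notNext T s₂≡)
    ... | inj₁ (_ , lab , _) = cong (λ L → at (L ++ trace f n (Stage.next r)) 0) lab

AdjacentC : List (Op × ℕ) → ℕ → Set
AdjacentC W v = ∃ λ p → at W p ≡ just (C , v) × at W (suc p) ≡ just (C , suc v)

CBeforeE : List (Op × ℕ) → ℕ → Set
CBeforeE W v = ∃₂ λ p q → p < q × at W p ≡ just (C , v) × at W q ≡ just (E , suc v)

Dichotomy : List (Op × ℕ) → ℕ → Set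
Dichotomy W v = AdjacentC W v ⊎ CBeforeE W v

dichotomy-++ : ∀ L {W} v → Dichotomy W v → Dichotomy (L ++ W) v
dichotomy-++ L {W} v (inj₁ (p , Cv , Cv+1)) =
  inj₁ (length L + p , trans (at-++ L W p) Cv , trans (cong (at (L ++ W)) (sym (+-suc (length L) p))) (trans (at-++ L W (suc p)) Cv+1))
dichotomy-++ L {W} v (inj₂ (p , q , p<q , Cv , Ev+1)) =
  inj₂ (length L + p , length L + q , +-monoʳ-< (length L) p<q , trans (at-++ L W p) Cv , trans (at-++ L W q) Ev+1)

ascending-least : ∀ {m l} → Ascending l → All (m <_) l → suc m ∈ l → ∃ λ T → l ≡ suc m ∷ T
ascending-least _ _ (here refl) = _ , refl
ascending-least as (m<t ∷ _) (there p) = ⊥-elim (<-irrefl refl (≤-<-trans m<t (All.lookup (ascending-head as) p)))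

-- Right after ADI outputs k+1, the value k+2 is either still in the input,
-- hence entered later, or on top of the second stack, hence output next: it
-- cannot be on the first stack, whose entries lie below the output value k+1.
afterOutput : ∀ f {n k} s → Invariant n s (suc k) → All (_< suc k) (stack1 s) → suc (suc k) ≤ n → μ s ≤ f →
              at (trace f n s) 0 ≡ just (C , suc (suc k)) ⊎ Occurs (trace f n s) (E , suc (suc k))
afterOutput f {n} {k} s g s₁<k+1 k+2≤n μ≤ with ∈-++⁻ (input s) (content-complete (Invariant.completable g) (n<1+n (suc k)) k+2≤n)
... | inj₁ inInput = inj₂ (trace-enters f s g μ≤ inInput)
... | inj₂ onStacks with ∈-++⁻ (stack1 s) onStacks
...   | inj₁ inStack1 = ⊥-elim (<-irrefl refl (<-trans (n<1+n (suc k)) (All.lookup s₁<k+1 inStack1)))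
...   | inj₂ inStack2 with ascending-least (stack2-ascending (Invariant.completable g)) (stack2-above (Invariant.completable g)) inStack2
...     | T , s₂≡ = inj₁ (trace-outputsNext f s g s₂≡ μ≤)

outputThen : ∀ {W v} → at W 0 ≡ just (C , suc v) ⊎ Occurs W (E , suc v) → Dichotomy ((C , v) ∷ W) v
outputThen (inj₁ Cv+1) = inj₁ (0 , refl , Cv+1)
outputThen (inj₂ (q , Ev+1)) = inj₂ (0 , suc q , s≤s z≤n , refl , Ev+1)

adjacent-or-before : ∀ f {n k} s → Invariant n s k → μ s ≤ f → ∀ v → k < v → suc v ≤ n → Dichotomy (trace f n s) v
adjacent-or-before zero s g μ≤0 v k<v v<n = ⊥-elim (noFuel s (content-complete (Invariant.completable g) k<v (<⇒≤ v<n)) μ≤0)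
adjacent-or-before (suc f) {n} {k} s g μ≤ v k<v v<n = afterStage (stageStep s g unfin)
  where
    unfin = unfinished s (content-complete (Invariant.completable g) k<v (<⇒≤ v<n))
    continue : (r : Stage n k s) → Dichotomy (trace f n (Stage.next r)) v → Dichotomy (trace (suc f) n s) v
    continue r = subst (λ W → Dichotomy W v) (sym (trace-unfold f s r unfin)) ∘ dichotomy-++ (labelled (Stage.ops r) s) v
    afterStage : Stage n k s → Dichotomy (trace (suc f) n s) v
    afterStage r with Stage.kind r
    ... | inj₂ (k'≡k , _) = continue r
            (adjacent-or-before f (Stage.next r) (subst (Invariant n (Stage.next r)) k'≡k (Stage.keeps r)) (fuelLeft r μ≤) v k<v v<n)
    ... | inj₁ (k'≡ , lab , _ , s₁≡ , s₂≡) with v ≟ suc k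
    ...   | no v≢ = continue r (adjacent-or-before f (Stage.next r) g' (fuelLeft r μ≤) v (≤∧≢⇒< k<v (λ e → v≢ (sym e))) v<n)
      where g' = subst (Invariant n (Stage.next r)) k'≡ (Stage.keeps r)
    ...   | yes refl = subst (λ W → Dichotomy W v) (sym (trans (trace-unfold f s r unfin) (cong (_++ trace f n (Stage.next r)) lab)))
            (outputThen (afterOutput f (Stage.next r) g' s₁<k+1 v<n (fuelLeft r μ≤)))
      where
        g' = subst (Invariant n (Stage.next r)) k'≡ (Stage.keeps r)
        s₁<k+1 : All (_< suc k) (stack1 (Stage.next r))
        s₁<k+1 = subst (All (_< suc k)) (sym s₁≡) (All.map (λ a<s₂ → All.head (subst (All _) s₂≡ a<s₂)) (Invariant.stack1<stack2 g))

lemma2p10 : (n : ℕ) → 1 ≤ n → (π : List ℕ) → IsPerm n π → DISortable n π →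
    (i : Fin (length π)) → lookup π i ≢ n →
    let W = labelled (ADIWord n π) (initial π) in
    ¬ (∃ λ k → at W k ≡ just (C , lookup π i) × at W (suc k) ≡ just (C , suc (lookup π i))) →
    ∃₂ λ p q → p < q × at W p ≡ just (C , lookup π i) × at W q ≡ just (E , suc (lookup π i))
lemma2p10 n _ π perm (w , (sf , runs , sorted) , di) i v≢n notAdjacent =
  [ ⊥-elim ∘ notAdjacent , id ]′ (adjacent-or-before (3 * n) (initial π) start (≤-reflexive (cong (3 *_) length≡n)) v 0<v v<n)
  where
    length≡n : length π ≡ n
    length≡n = trans (↭-length perm) (length-oneTo n)
    start : Invariant n (initial π) 0
    start = invariant refl (diWord⇒completable n w (initial π) 0 refl size sf runs sorted di) [] []
      where size = trans (+-identityʳ _) (trans (+-identityʳ _) (trans (+-identityʳ _) length≡n))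
    v = lookup π i
    v-range : 0 < v × v < 1 + n
    v-range = ∈-interval⁻ 1 n (subst (v ∈_) (oneTo≡interval n) (∈-resp-↭ perm (∈-lookup i)))
    0<v : 0 < v
    0<v = proj₁ v-range
    v<n : suc v ≤ n
    v<n = ≤∧≢⇒< (≤-pred (proj₂ v-range)) v≢n
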